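{- Let $G$ and $H$ be finite simple graphs, let $U\subseteq V_G$, and let $k$ be an integer. Then $$\gamma^d_k(G(U)\sqcap H)\leq \gamma^d_{k}(G)\,n(H),$$ where $n(H)=|V_H|$.
   Context: All graphs are finite and simple. For a graph $G$ and $v\in V_G$, $\deg_G(v)$ is the degree of $v$ and $\delta_G$ the minimum degree. For $S\subseteq V_G$, $\bar S=V_G\setminus S$ and $N_S(v)=\{u\in S: uv\in E_G\}$. A set $D\subseteq V_G$ is dominating if every vertex not in $D$ has a neighbor in $D$. For an integer $k$ (the paper considers $k\in\{ -\delta_G,\dots,\delta_G\}$), a nonempty set $S\subseteq V_G$ is a global defensive $k$-alliance of $G$ if $S$ is a dominating set of $G$ and $|N_S(v)|\ge |N_{\bar S}(v)|+k$ for every $v\in S$. The global defensive $k$-alliance number $\gamma^d_k(G)$ is the minimum cardinality of a global defensive $k$-alliance of $G$, and $\gamma^d_k(G)=\infty$ if none exists. For graphs $G,H$ and $U\subseteq V_G$, the generalized hierarchical product $G(U)\sqcap H$ has vertex set $V_G\times V_H$, with $(g,h)$ adjacent to $(g',h')$ iff either $g=g'\in U$ and $hh'\in E_H$, or $gg'\in E_G$ and $h=h'$. -}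

module Defs where

open import Data.Nat using (ℕ; _*_; _≤_)
open import Data.Bool using (Bool; true; false; _∧_; _∨_)
open import Data.Fin using (Fin; remQuot; _≟_)
open import Data.Fin.Subset using (Subset; _∈_; _∉_; ∣_∣; ∁; _∩_; Nonempty)
open import Data.Vec using (tabulate)
open import Data.Integer using (ℤ; +_) renaming (_+_ to _+ℤ_; _≤_ to _≤ℤ_)
open import Data.Product using (Σ; _×_; _,_)
open import Relation.Binary.PropositionalEquality using (_≡_)
open import Relation.Nullary.Decidable using (⌊_⌋)

record Graph : Set where
  field
    n   : ℕ
    adj : Fin n → Fin n → Bool
open Graph public

record IsSimple (G : Graph) : Set where
  field
    symmetric : ∀ u v → adj G u v ≡ adj G v u
    loopless  : ∀ v → adj G v v ≡ false
    nonempty  : 1 ≤ n G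

Nbhd : (G : Graph) → Fin (n G) → Subset (n G)
Nbhd G v = tabulate (adj G v)

degIn : (G : Graph) → Subset (n G) → Fin (n G) → ℕ
degIn G S v = ∣ S ∩ Nbhd G v ∣

IsDominating : (G : Graph) → Subset (n G) → Set
IsDominating G S = ∀ v → v ∉ S → Σ (Fin (n G)) λ u → u ∈ S × adj G v u ≡ true

IsGlobalDefensiveAlliance : (G : Graph) → ℤ → Subset (n G) → Set
IsGlobalDefensiveAlliance G k S =
  Nonempty S × IsDominating G S ×
  (∀ v → v ∈ S → (+ degIn G (∁ S) v) +ℤ k ≤ℤ + degIn G S v)

-- γ^d_k(G) = m (finite value): some alliance has size m and every alliance has size ≥ m.
-- (γ^d_k(G) = ∞ corresponds to there being no m with this property.)
IsGDANumber : (G : Graph) → ℤ → ℕ → Set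
IsGDANumber G k m =
  (Σ (Subset (n G)) λ S → IsGlobalDefensiveAlliance G k S × ∣ S ∣ ≡ m) ×
  (∀ S → IsGlobalDefensiveAlliance G k S → m ≤ ∣ S ∣)

-- Generalized hierarchical product G(U) ⊓ H, with vertex set Fin (n G * n H)
-- identified with Fin (n G) × Fin (n H) via remQuot.
HProd : (G : Graph) → Subset (n G) → Graph → Graph
HProd G U H = record
  { n   = n G * n H
  ; adj = λ x y → adjP (remQuot (n H) x) (remQuot (n H) y)
  }
  where
  adjP : (Fin (n G) × Fin (n H)) → (Fin (n G) × Fin (n H)) → Bool
  adjP (g , h) (g' , h') =
    (⌊ g ≟ g' ⌋ ∧ Data.Vec.lookup U g ∧ adj H h h') ∨ (adj G g g' ∧ ⌊ h ≟ h' ⌋)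

module Submission where

-- Let S be a minimum global defensive k-alliance of G and put P = S × V_H in G(U) ⊓ H.
-- For (g , h) ∈ P, the neighbours outside P all lie in the copy of G through h (the
-- other neighbours share the coordinate g ∈ S), so they correspond to neighbours of g
-- outside S; conversely every neighbour g′ ∈ S of g yields the neighbour (g′ , h) ∈ P.
-- Hence P inherits the alliance inequality, and it dominates because the copy of G
-- through each h is dominated.

open import Defs
open import Data.Nat using (ℕ; _*_; _≤_)
open import Data.Integer using (ℤ)
open import Data.Fin.Subset using (Subset)
open import Data.Product using (Σ; _×_)

open import Data.Bool using (Bool; true; false; _∧_; if_then_else_)
import Data.Bool as Bool
open import Data.Bool.Properties using (∨-zeroʳ)
open import Data.Nat using (zero; suc; _+_; _<_)
open import Data.Nat.Properties
  using (*-identityʳ; _<?_; ≮⇒≥; ≤-refl; ≤-trans; <⇒≤; ≤-reflexive; module ≤-Reasoning)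
open import Data.Nat.Induction using (<-wellFounded)
open import Data.Integer using (+_; +≤+) renaming (_+_ to _+ℤ_; _≤_ to _≤ℤ_)
import Data.Integer.Properties as ℤ
open import Data.Fin
  using (Fin; zero; suc; _↑ˡ_; _↑ʳ_; combine; remQuot; quotient; remainder; fromℕ<; _≟_)
open import Data.Fin.Properties using (remQuot-combine; splitAt-↑ʳ; all?; any?)
open import Data.Fin.Subset using (Nonempty; _∈_; _⊆_; _∩_; ∁; ∣_∣; ⊤; ⁅_⁆)
open import Data.Fin.Subset.Properties
  using ( _∈?_; nonempty?; anySubset?; p⊆q⇒∣p∣≤∣q∣; ∣⊤∣≡n; ∣⁅x⁆∣≡1; ∈⊤; x∈⁅x⁆; x∈⁅y⁆⇒x≡y
        ; x∈p∩q⁺; x∈p∩q⁻; x∈∁p⇒x∉p; x∉p⇒x∈∁p)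
open import Data.Vec using ([]; _∷_; lookup; tabulate)
open import Data.Vec.Properties
  using (tabulate∘lookup; tabulate-cong; lookup∘tabulate; lookup⇒[]=; []=⇒lookup)
open import Data.Product using (_,_; proj₁)
open import Data.Product.Properties using (×-≡,≡←≡)
open import Data.Sum using (_⊎_; inj₁; inj₂)
open import Function using (_∘_)
open import Induction.WellFounded using (Acc; acc)
open import Relation.Binary.PropositionalEquality
open import Relation.Nullary using (yes; no; contradiction)
open import Relation.Nullary.Decidable using (_×-dec_; _→-dec_; ¬?)
open import Relation.Unary using (Pred; Decidable)

∈-tabulate⁺ : ∀ {n} {f : Fin n → Bool} {x} → f x ≡ true → x ∈ tabulate f
∈-tabulate⁺ {f = f} {x} fx = lookup⇒[]= x (tabulate f) (trans (lookup∘tabulate f x) fx)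

∈-tabulate⁻ : ∀ {n} {f : Fin n → Bool} {x} → x ∈ tabulate f → f x ≡ true
∈-tabulate⁻ {f = f} {x} x∈ = trans (sym (lookup∘tabulate f x)) ([]=⇒lookup x∈)

∣tabulate∣-↑ : ∀ a {b} (f : Fin (a + b) → Bool) →
  ∣ tabulate f ∣ ≡ ∣ tabulate (f ∘ (_↑ˡ b)) ∣ + ∣ tabulate (f ∘ (a ↑ʳ_)) ∣
∣tabulate∣-↑ zero    f = refl
∣tabulate∣-↑ (suc a) f with f zero | ∣tabulate∣-↑ a (f ∘ suc)
... | true  | ih = cong suc ih
... | false | ih = ih

∣tabulate-∧∣ : ∀ {k} a (B : Subset k) →
  ∣ tabulate (λ h → a ∧ lookup B h) ∣ ≡ (if a then ∣ B ∣ else 0)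
∣tabulate-∧∣     true  B = cong ∣_∣ (tabulate∘lookup B)
∣tabulate-∧∣ {k} false B = ∣tabulate-false∣ {k}
  where
  ∣tabulate-false∣ : ∀ {n} → ∣ tabulate {n = n} (λ _ → false) ∣ ≡ 0
  ∣tabulate-false∣ {zero}  = refl
  ∣tabulate-false∣ {suc n} = ∣tabulate-false∣ {n}

remQuot-↑ʳ : ∀ {m} k (y : Fin (m * k)) →
  remQuot {suc m} k (k ↑ʳ y) ≡ (suc (quotient k y) , remainder {m} k y)
remQuot-↑ʳ {m} k y rewrite splitAt-↑ʳ k (m * k) y = refl

infixr 7 _⊠_
_⊠_ : ∀ {m k} → Subset m → Subset k → Subset (m * k)
_⊠_ {m} {k} A B = tabulate λ y → lookup A (quotient k y) ∧ lookup B (remainder {m} k y)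

∣⊠∣ : ∀ {m k} (A : Subset m) (B : Subset k) → ∣ A ⊠ B ∣ ≡ ∣ A ∣ * ∣ B ∣
∣⊠∣             []      B = refl
∣⊠∣ {suc m} {k} (a ∷ A) B = begin
  ∣ (a ∷ A) ⊠ B ∣
    ≡⟨ ∣tabulate∣-↑ k _ ⟩
  ∣ tabulate (f ∘ (_↑ˡ m * k)) ∣ + ∣ tabulate (f ∘ (k ↑ʳ_)) ∣
    ≡⟨ cong₂ (λ p q → ∣ p ∣ + ∣ q ∣) (tabulate-cong first-row) (tabulate-cong other-rows) ⟩
  ∣ tabulate (λ h → a ∧ lookup B h) ∣ + ∣ A ⊠ B ∣
    ≡⟨ cong₂ _+_ (∣tabulate-∧∣ a B) (∣⊠∣ A B) ⟩
  (if a then ∣ B ∣ else 0) + ∣ A ∣ * ∣ B ∣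
    ≡⟨ row-sum a ⟩
  ∣ a ∷ A ∣ * ∣ B ∣ ∎
  where
  open ≡-Reasoning
  f : Fin (suc m * k) → Bool
  f y = lookup (a ∷ A) (quotient k y) ∧ lookup B (remainder {suc m} k y)
  first-row : ∀ h → f (h ↑ˡ m * k) ≡ a ∧ lookup B h
  first-row h = cong (λ (g , h′) → lookup (a ∷ A) g ∧ lookup B h′) (remQuot-combine zero h)
  other-rows : ∀ y → f (k ↑ʳ y) ≡ lookup A (quotient k y) ∧ lookup B (remainder {m} k y)
  other-rows y = cong (λ (g , h′) → lookup (a ∷ A) g ∧ lookup B h′) (remQuot-↑ʳ k y)
  row-sum : ∀ a → (if a then ∣ B ∣ else 0) + ∣ A ∣ * ∣ B ∣ ≡ ∣ a ∷ A ∣ * ∣ B ∣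
  row-sum true  = refl
  row-sum false = refl

∣⊠⁅⁆∣ : ∀ {m k} (A : Subset m) (h : Fin k) → ∣ A ⊠ ⁅ h ⁆ ∣ ≡ ∣ A ∣
∣⊠⁅⁆∣ A h = trans (∣⊠∣ A ⁅ h ⁆) (trans (cong (∣ A ∣ *_) (∣⁅x⁆∣≡1 h)) (*-identityʳ ∣ A ∣))

module _ {m k : ℕ} {A : Subset m} {B : Subset k} where

  ∈-⊠⁺ : ∀ {y} → quotient k y ∈ A → remainder {m} k y ∈ B → y ∈ A ⊠ B
  ∈-⊠⁺ q∈A r∈B = ∈-tabulate⁺ (cong₂ _∧_ ([]=⇒lookup q∈A) ([]=⇒lookup r∈B))

  ∈-⊠⁻ : ∀ {y} → y ∈ A ⊠ B → quotient k y ∈ A × remainder {m} k y ∈ B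
  ∈-⊠⁻ {y} y∈
    with lookup A (quotient k y) in q∈A | lookup B (remainder {m} k y) in r∈B | ∈-tabulate⁻ y∈
  ... | true | true | _ = lookup⇒[]= _ A q∈A , lookup⇒[]= _ B r∈B

  combine-∈-⊠ : ∀ {g h} → g ∈ A → h ∈ B → combine g h ∈ A ⊠ B
  combine-∈-⊠ {g} {h} g∈A h∈B =
    let q≡g , r≡h = ×-≡,≡←≡ (remQuot-combine {m} {k} g h)
    in ∈-⊠⁺ (subst (_∈ A) (sym q≡g) g∈A) (subst (_∈ B) (sym r≡h) h∈B)

  ⊠-nonempty : Nonempty A → Nonempty B → Nonempty (A ⊠ B)
  ⊠-nonempty (g , g∈A) (h , h∈B) = combine g h , combine-∈-⊠ g∈A h∈B

module HierarchicalProduct (G H : Graph) (U : Subset (n G)) where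

  private
    G⊓H : Graph
    G⊓H = HProd G U H
    π₁ : Fin (n G * n H) → Fin (n G)
    π₁ = quotient (n H)
    π₂ : Fin (n G * n H) → Fin (n H)
    π₂ = remainder {n G} (n H)

  adj-HProd⁻ : ∀ x y → adj G⊓H x y ≡ true →
    π₁ x ≡ π₁ y ⊎ (adj G (π₁ x) (π₁ y) ≡ true × π₂ x ≡ π₂ y)
  adj-HProd⁻ x y xy with π₁ x ≟ π₁ y | π₂ x ≟ π₂ y | adj G (π₁ x) (π₁ y) in gg′
  ... | yes g≡g′ | _        | _    = inj₁ g≡g′
  ... | no _     | yes h≡h′ | true = inj₂ (refl , h≡h′)

  adj-HProd⁺ : ∀ x y → adj G (π₁ x) (π₁ y) ≡ true → π₂ x ≡ π₂ y → adj G⊓H x y ≡ true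
  adj-HProd⁺ x y gg′ h≡h′ with π₂ x ≟ π₂ y
  ... | yes _   rewrite gg′ = ∨-zeroʳ _
  ... | no h≢h′ = contradiction h≡h′ h≢h′

  module _ (S : Subset (n G)) where

    ∈-⊠⊤⁺ : ∀ {y} → π₁ y ∈ S → y ∈ S ⊠ ⊤
    ∈-⊠⊤⁺ g∈S = ∈-⊠⁺ g∈S ∈⊤

    ∈-⊠⊤⁻ : ∀ {y} → y ∈ S ⊠ ⊤ → π₁ y ∈ S
    ∈-⊠⊤⁻ y∈ = proj₁ (∈-⊠⁻ {B = ⊤} y∈)

    degIn-⊠⊤ : ∀ v → degIn G S (π₁ v) ≤ degIn G⊓H (S ⊠ ⊤) v
    degIn-⊠⊤ v = begin
      degIn G S (π₁ v)                    ≡⟨ ∣⊠⁅⁆∣ (S ∩ Nbhd G (π₁ v)) (π₂ v) ⟨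
      ∣ (S ∩ Nbhd G (π₁ v)) ⊠ ⁅ π₂ v ⁆ ∣  ≤⟨ p⊆q⇒∣p∣≤∣q∣ layer⊆ ⟩
      degIn G⊓H (S ⊠ ⊤) v                 ∎
      where
      open ≤-Reasoning
      layer⊆ : (S ∩ Nbhd G (π₁ v)) ⊠ ⁅ π₂ v ⁆ ⊆ (S ⊠ ⊤) ∩ Nbhd G⊓H v
      layer⊆ y∈ =
        let g∈ , h∈ = ∈-⊠⁻ y∈
            g∈S , g∈N = x∈p∩q⁻ S _ g∈
            vy = adj-HProd⁺ v _ (∈-tabulate⁻ g∈N) (sym (x∈⁅y⁆⇒x≡y _ h∈))
        in x∈p∩q⁺ (∈-⊠⊤⁺ g∈S , ∈-tabulate⁺ vy)

    degIn-∁⊠⊤ : ∀ v → π₁ v ∈ S → degIn G⊓H (∁ (S ⊠ ⊤)) v ≤ degIn G (∁ S) (π₁ v)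
    degIn-∁⊠⊤ v g∈S = begin
      degIn G⊓H (∁ (S ⊠ ⊤)) v               ≤⟨ p⊆q⇒∣p∣≤∣q∣ ⊆layer ⟩
      ∣ (∁ S ∩ Nbhd G (π₁ v)) ⊠ ⁅ π₂ v ⁆ ∣  ≡⟨ ∣⊠⁅⁆∣ (∁ S ∩ Nbhd G (π₁ v)) (π₂ v) ⟩
      degIn G (∁ S) (π₁ v)                  ∎
      where
      open ≤-Reasoning
      ⊆layer : ∁ (S ⊠ ⊤) ∩ Nbhd G⊓H v ⊆ (∁ S ∩ Nbhd G (π₁ v)) ⊠ ⁅ π₂ v ⁆
      ⊆layer {y} y∈ with x∈p∩q⁻ (∁ (S ⊠ ⊤)) _ y∈
      ... | y∈∁ , y∈N with adj-HProd⁻ v y (∈-tabulate⁻ y∈N)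
      ... | inj₁ g≡g′ = contradiction (∈-⊠⊤⁺ (subst (_∈ S) g≡g′ g∈S)) (x∈∁p⇒x∉p y∈∁)
      ... | inj₂ (gg′ , h≡h′) = ∈-⊠⁺
        (x∈p∩q⁺ (x∉p⇒x∈∁p (x∈∁p⇒x∉p y∈∁ ∘ ∈-⊠⊤⁺) , ∈-tabulate⁺ gg′))
        (subst (_∈ ⁅ π₂ v ⁆) h≡h′ (x∈⁅x⁆ (π₂ v)))

    ⊠⊤-isDominating : IsDominating G S → IsDominating G⊓H (S ⊠ ⊤)
    ⊠⊤-isDominating S-dom v v∉ =
      let g′ , g′∈S , gg′ = S-dom (π₁ v) (v∉ ∘ ∈-⊠⊤⁺)
          q≡g′ , r≡h = ×-≡,≡←≡ (remQuot-combine {n G} {n H} g′ (π₂ v))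
      in combine g′ (π₂ v) , combine-∈-⊠ g′∈S ∈⊤ ,
         adj-HProd⁺ v _ (subst (λ g → adj G (π₁ v) g ≡ true) (sym q≡g′) gg′) (sym r≡h)

    ⊠⊤-isGDA : ∀ k → 1 ≤ n H →
      IsGlobalDefensiveAlliance G k S → IsGlobalDefensiveAlliance G⊓H k (S ⊠ ⊤)
    ⊠⊤-isGDA k 1≤nH (S-nonempty , S-dom , S-def) =
      ⊠-nonempty S-nonempty (fromℕ< 1≤nH , ∈⊤) , ⊠⊤-isDominating S-dom , ⊠⊤-def
      where
      ⊠⊤-def : ∀ v → v ∈ S ⊠ ⊤ → + degIn G⊓H (∁ (S ⊠ ⊤)) v +ℤ k ≤ℤ + degIn G⊓H (S ⊠ ⊤) v
      ⊠⊤-def v v∈ = begin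
        + degIn G⊓H (∁ (S ⊠ ⊤)) v +ℤ k  ≤⟨ ℤ.+-monoˡ-≤ k (+≤+ (degIn-∁⊠⊤ v (∈-⊠⊤⁻ v∈))) ⟩
        + degIn G (∁ S) (π₁ v) +ℤ k     ≤⟨ S-def (π₁ v) (∈-⊠⊤⁻ v∈) ⟩
        + degIn G S (π₁ v)              ≤⟨ +≤+ (degIn-⊠⊤ v) ⟩
        + degIn G⊓H (S ⊠ ⊤) v           ∎
        where open ℤ.≤-Reasoning

minimal-subset : ∀ {n ℓ} {P : Pred (Subset n) ℓ} → Decidable P → ∀ {S} → P S →
  Σ (Subset n) λ T → P T × (∀ T′ → P T′ → ∣ T ∣ ≤ ∣ T′ ∣) × ∣ T ∣ ≤ ∣ S ∣
minimal-subset {n} {P = P} P? {S} = go S (<-wellFounded ∣ S ∣)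
  where
  go : ∀ S → Acc _<_ ∣ S ∣ → P S →
    Σ (Subset n) λ T → P T × (∀ T′ → P T′ → ∣ T ∣ ≤ ∣ T′ ∣) × ∣ T ∣ ≤ ∣ S ∣
  go S (acc smaller) S∈P with anySubset? (λ T → P? T ×-dec ∣ T ∣ <? ∣ S ∣)
  ... | no ∄smaller = S , S∈P , (λ T T∈P → ≮⇒≥ (λ T<S → ∄smaller (T , T∈P , T<S))) , ≤-refl
  ... | yes (T , T∈P , T<S) =
    let T′ , T′∈P , T′-min , T′≤T = go T (smaller T<S) T∈P
    in T′ , T′∈P , T′-min , ≤-trans T′≤T (<⇒≤ T<S)

isGDA? : ∀ G k → Decidable (IsGlobalDefensiveAlliance G k)
isGDA? G k S =
  nonempty? S ×-dec
  all? (λ v → ¬? (v ∈? S) →-dec any? λ u → u ∈? S ×-dec adj G v u Bool.≟ true) ×-dec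
  all? (λ v → v ∈? S →-dec _ ℤ.≤? _)

gdaNumber-≤ : ∀ G k {S} → IsGlobalDefensiveAlliance G k S →
  Σ ℕ λ p → IsGDANumber G k p × p ≤ ∣ S ∣
gdaNumber-≤ G k S-gda =
  let T , T-gda , T-min , ∣T∣≤∣S∣ = minimal-subset (isGDA? G k) S-gda
  in ∣ T ∣ , ((T , T-gda , refl) , T-min) , ∣T∣≤∣S∣

theorem2p1 : (G H : Graph) → IsSimple G → IsSimple H →
    (U : Subset (n G)) (k : ℤ) (m : ℕ) → IsGDANumber G k m →
    Σ ℕ (λ p → IsGDANumber (HProd G U H) k p × p ≤ m * n H)
theorem2p1 G H _ H-simple U k m ((S , S-gda , ∣S∣≡m) , _) =
  let open HierarchicalProduct G H U
      S⊠⊤-gda = ⊠⊤-isGDA S k (IsSimple.nonempty H-simple) S-gda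
      p , p-number , p≤∣S⊠⊤∣ = gdaNumber-≤ (HProd G U H) k S⊠⊤-gda
      ∣S⊠⊤∣≡m*nH = trans (∣⊠∣ S ⊤) (cong₂ _*_ ∣S∣≡m (∣⊤∣≡n (n H)))
  in p , p-number , ≤-trans p≤∣S⊠⊤∣ (≤-reflexive ∣S⊠⊤∣≡m*nH)
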